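{- Let $n\ge1$, $d\ge0$ and let $u=(u^{[K]};u^{[I]})$ be a sorted compact configuration on $S_{n,d}$. Then \[ \begin{aligned} T_s.u&=\left(u^{[K]}+1^{[K]};\,u^{[I]}+1^{[I]}\right),\\ T_K.u&=\left(\tau_{[K]}.\left(u^{[K]}-(n+d+1)^{[0_K]}+1^{[K]}\right);\,u^{[I]}+1^{[I]}\right),\\ T_I.u&=\left(u^{[K]}+1^{[K]};\,\tau_{[I]}.\left(u^{[I]}-(n+1)^{[0_I]}\right)\right), \end{aligned} \] and all three are compact configurations. Moreover, these operators restricted to sorted compact configurations are reversible, with \[ \begin{aligned} T_s^{ -1}.u&=\left(u^{[K]}-1^{[K]};\,u^{[I]}-1^{[I]}\right),\\ T_K^{ -1}.u&=\left(\left(\tau_{[K]}^{ -1}.u^{[K]}\right)+(n+d+1)^{[0_K]}-1^{[K]};\,u^{[I]}-1^{[I]}\right),\\ T_I^{ -1}.u&=\left(u^{[K]}-1^{[K]};\,\left(\tau_{[I]}^{ -1}.u^{[I]}\right)+(n+1)^{[0_I]}\right). \end{aligned} \]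
   Context: The complete split graph $S_{n,d}$ has a sink $s$, clique component $K=\{v_1,\ldots,v_n\}$ (positions $0,\ldots,n-1$) and independent component $I=\{w_1,\ldots,w_d\}$ (positions $0,\ldots,d-1$); any two distinct vertices among $s,v_1,\ldots,v_n$ are adjacent, each $w_j$ is adjacent to each of $s,v_1,\ldots,v_n$, no two $w_j$'s are adjacent; $\deg(v_i)=\deg(s)=n+d$, $\deg(w_j)=n+1$. A configuration is any $u=(u^{[K]};u^{[I]})\in\mathbb{Z}^n\times\mathbb{Z}^d$, the sink carrying $u_s=-(\text{sum of all entries})$. $\Delta^{(v)}$ is the toppling vector of vertex $v$ (including $v=s$): adding it removes $\deg(v)$ grains from $v$ and adds one grain to each neighbour. A configuration is sorted if $u^{[K]}$ and $u^{[I]}$ are weakly decreasing; $\mathsf{sort}(u)$ denotes the configuration obtained by sorting each of $u^{[K]}$, $u^{[I]}$ into weakly decreasing order. $u$ is compact if $\max_k u^{[K]}_k-\min_k u^{[K]}_k\le n+d+1$ and $\max_i u^{[I]}_i-\min_i u^{[I]}_i\le n+1$. Operators: $T_s.u=\mathsf{sort}(u+\Delta^{(s)})$, and for $C\in\{K,I\}$, $T_C.u=\mathsf{sort}(u+\Delta^{(c)})$ where $c$ is a vertex of $C$ with the maximal number of grains in $C$. Notation: for a component $C$ and integer $k$, $k^{[C]}$ is the constant vector $(k,\ldots,k)$ on $C$ and $k^{[0_C]}$ has $k$ at position $0$ of $C$ and $0$ elsewhere; $\tau_{[C]}$ is the cyclic shift moving position $0$ to the last position: $\tau_{[C]}.(x_0,x_1,\ldots,x_{|C|-1})=(x_1,\ldots,x_{|C|-1},x_0)$,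 and $\tau_{[C]}^{ -1}.(x_0,\ldots,x_{|C|-1})=(x_{|C|-1},x_0,\ldots,x_{|C|-2})$. -}

module Defs where

open import Data.Nat as ℕ using (ℕ; zero; suc)
open import Data.Integer as ℤ using (ℤ; +_; -_; _+_; _-_; _≤_; _≤?_)
open import Data.Fin as Fin using (Fin; toℕ)
open import Data.Fin.Properties using () renaming (_≟_ to _≟F_)
open import Data.Vec using (Vec; []; _∷_; _∷ʳ_; zipWith; replicate; tabulate; lookup; map; init; last)
open import Data.Product using (_×_; _,_; proj₁; proj₂)
open import Data.Bool using (Bool; true; false; if_then_else_; not)
open import Relation.Nullary using (yes; no; Dec)
open import Relation.Nullary.Decidable using (⌊_⌋)

data Vtx (n d : ℕ) : Set where
  sink : Vtx n d
  vK   : Fin n → Vtx n d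
  wI   : Fin d → Vtx n d

adj : ∀ {n d} → Vtx n d → Vtx n d → Bool
adj sink     sink     = false
adj sink     (vK _)   = true
adj sink     (wI _)   = true
adj (vK _)   sink     = true
adj (vK i)   (vK i')  = not ⌊ i ≟F i' ⌋
adj (vK _)   (wI _)   = true
adj (wI _)   sink     = true
adj (wI _)   (vK _)   = true
adj (wI _)   (wI _)   = false

sameV : ∀ {n d} → Vtx n d → Vtx n d → Bool
sameV sink   sink    = true
sameV (vK i) (vK i') = ⌊ i ≟F i' ⌋
sameV (wI j) (wI j') = ⌊ j ≟F j' ⌋
sameV _      _       = false

deg : ∀ {n d} → Vtx n d → ℕ
deg {n} {d} sink   = n ℕ.+ d
deg {n} {d} (vK _) = n ℕ.+ d
deg {n} {d} (wI _) = n ℕ.+ 1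

Δ : ∀ {n d} → Vtx n d → Vtx n d → ℤ
Δ v x = if sameV v x then - (+ deg v) else (if adj v x then + 1 else + 0)

-- Configurations (the sink value is implicit: u_s = - sum of entries)

Config : ℕ → ℕ → Set
Config n d = Vec ℤ n × Vec ℤ d

_⊕_ : ∀ {m} → Vec ℤ m → Vec ℤ m → Vec ℤ m
_⊕_ = zipWith _+_

_⊖_ : ∀ {m} → Vec ℤ m → Vec ℤ m → Vec ℤ m
_⊖_ = zipWith _-_

infixl 6 _⊕_ _⊖_

const : ∀ {m} → ℤ → Vec ℤ m
const k = replicate _ k

at0 : ∀ {m} → ℤ → Vec ℤ m
at0 k = tabulate (λ i → if ⌊ toℕ i ℕ.≟ 0 ⌋ then k else + 0)

topple : ∀ {n d} → Vtx n d → Config n d → Config n d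
topple v (uK , uI) = uK ⊕ tabulate (λ i → Δ v (vK i)) , uI ⊕ tabulate (λ j → Δ v (wI j))

insertDec : ∀ {m} → ℤ → Vec ℤ m → Vec ℤ (suc m)
insertDec x [] = x ∷ []
insertDec x (y ∷ ys) with y ≤? x
... | yes _ = x ∷ y ∷ ys
... | no  _ = y ∷ insertDec x ys

sortDec : ∀ {m} → Vec ℤ m → Vec ℤ m
sortDec []       = []
sortDec (x ∷ xs) = insertDec x (sortDec xs)

sort : ∀ {n d} → Config n d → Config n d
sort (uK , uI) = sortDec uK , sortDec uI

Decreasing : ∀ {m} → Vec ℤ m → Set
Decreasing v = ∀ i j → i Fin.≤ j → lookup v j ≤ lookup v i

Sorted : ∀ {n d} → Config n d → Set
Sorted (uK , uI) = Decreasing uK × Decreasing uI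

-- max - min ≤ bound, written as: every pairwise difference ≤ bound
Spread≤ : ∀ {m} → Vec ℤ m → ℕ → Set
Spread≤ v b = ∀ i j → lookup v i - lookup v j ≤ + b

Compact : ∀ {n d} → Config n d → Set
Compact {n} {d} (uK , uI) = Spread≤ uK (n ℕ.+ d ℕ.+ 1) × Spread≤ uI (n ℕ.+ 1)

IsMaxPos : ∀ {m} → Vec ℤ m → Fin m → Set
IsMaxPos v c = ∀ i → lookup v i ≤ lookup v c

T-s : ∀ {n d} → Config n d → Config n d
T-s u = sort (topple sink u)

-- T_K, given the chosen maximal vertex c of K
T-K : ∀ {n d} → Fin n → Config n d → Config n d
T-K c u = sort (topple (vK c) u)

-- T_I, given the chosen maximal vertex c of I
T-I : ∀ {n d} → Fin d → Config n d → Config n d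
T-I c u = sort (topple (wI c) u)

τ : ∀ {m} → Vec ℤ m → Vec ℤ m
τ []       = []
τ (x ∷ xs) = xs ∷ʳ x

τ⁻¹ : ∀ {m} → Vec ℤ m → Vec ℤ m
τ⁻¹ []       = []
τ⁻¹ (x ∷ xs) = last (x ∷ xs) ∷ init (x ∷ xs)

Tinv-s : ∀ {n d} → Config n d → Config n d
Tinv-s (uK , uI) = uK ⊖ const (+ 1) , uI ⊖ const (+ 1)

Tinv-K : ∀ {n d} → Config n d → Config n d
Tinv-K {n} {d} (uK , uI) = τ⁻¹ uK ⊕ at0 (+ (n ℕ.+ d ℕ.+ 1)) ⊖ const (+ 1) , uI ⊖ const (+ 1)

Tinv-I : ∀ {n d} → Config n d → Config n d
Tinv-I {n} {d} (uK , uI) = uK ⊖ const (+ 1) , τ⁻¹ uI ⊕ at0 (+ (n ℕ.+ 1))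

{-# OPTIONS --safe #-}
-- Write a sorted component as x ∷ xs with x its maximum. Toppling the sink adds 1 to every
-- entry, which keeps the vector sorted. Toppling a maximal vertex c of a component lowers its
-- entry by deg c + 1 relative to all other entries of that component, and compactness says
-- precisely that it is then still ≤ each of them. Since every entry in front of c equals x,
-- sorting turns the result into xs ∷ʳ (x - k) plus a uniform shift, which is the rotation
-- τ (u - k^[0]) of the formulas. This vector lies in the window [x - k, x], hence is again
-- sorted and compact, and the rotation is undone by ys ∷ʳ y ↦ (y + k) ∷ ys, which commutes
-- with uniform shifts.
module Submission where

open import Defs
open import Data.Nat as ℕ using (ℕ; zero; suc; z≤n; s≤s)
open import Data.Integer using (ℤ; +_; -_; _+_; _-_; _≤_; _≥_; _≤?_)
open import Data.Integer.Properties
  using ( ≤-refl; ≤-trans; ≤-antisym; ≤-reflexive; +-mono-≤; +-monoˡ-≤; neg-mono-≤; i≤i+j; i-j≤i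
        ; pos-+; +-identityʳ; +-comm; module ≤-Reasoning)
open import Data.Integer.Tactic.RingSolver using (solve-∀)
open import Data.Fin using (Fin; zero; suc)
open import Data.Fin.Properties using (suc-injective) renaming (_≟_ to _≟F_)
open import Data.Vec
  using (Vec; []; _∷_; _∷ʳ_; head; tail; lookup; replicate; tabulate; zipWith; initLast; _[_]≔_)
open import Data.Vec.Properties using (lookup-zipWith; lookup-replicate; tabulate-cong; init-∷ʳ; last-∷ʳ)
open import Data.Vec.Relation.Unary.All as All using (All; []; _∷_)
open import Data.Vec.Relation.Unary.All.Properties using (lookup⁺; lookup⁻)
open import Data.Vec.Relation.Unary.AllPairs as AllPairs using (AllPairs; []; _∷_)
open import Data.Product using (_×_; _,_; proj₁; proj₂; uncurry)
open import Function using (_∘_)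
open import Relation.Nullary using (yes; no; contradiction)
open import Relation.Binary.PropositionalEquality

i-k≡[i-j]+[j-k] : ∀ i j k → i - k ≡ (i - j) + (j - k)
i-k≡[i-j]+[j-k] = solve-∀

i+[j-i]≡j : ∀ i j → i + (j - i) ≡ j
i+[j-i]≡j = solve-∀

i≡[i-j]+j : ∀ i j → i ≡ (i - j) + j
i≡[i-j]+j = solve-∀

i+j-j≡i : ∀ i j → i + j - j ≡ i
i+j-j≡i = solve-∀

i-j+j≡i : ∀ i j → i - j + j ≡ i
i-j+j≡i = solve-∀

i+j+k≡i+k+j : ∀ i j k → i + j + k ≡ i + k + j
i+j+k≡i+k+j = solve-∀

i-[i-j]≡j : ∀ i j → i - (i - j) ≡ j
i-[i-j]≡j = solve-∀

i+j-i≡j : ∀ i j → i + j - i ≡ j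
i+j-i≡j = solve-∀

i-[j+1]+1≡i-j : ∀ i j → i - (j + + 1) + + 1 ≡ i - j
i-[j+1]+1≡i-j = solve-∀

i+k-[j+k]≡i-j : ∀ i j k → (i + k) - (j + k) ≡ i - j
i+k-[j+k]≡i-j = solve-∀

i-j≤k⇒i-k≤j : ∀ i j {k} → i - j ≤ k → i - k ≤ j
i-j≤k⇒i-k≤j i j {k} i-j≤k = begin
  i - k             ≡⟨ i-k≡[i-j]+[j-k] i j k ⟩
  (i - j) + (j - k) ≤⟨ +-monoˡ-≤ (j - k) i-j≤k ⟩
  k + (j - k)       ≡⟨ i+[j-i]≡j k j ⟩
  j                 ∎
  where open ≤-Reasoning

i-j≤k⇒i≤j+k : ∀ i j {k} → i - j ≤ k → i ≤ j + k
i-j≤k⇒i≤j+k i j {k} i-j≤k = begin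
  i           ≡⟨ i≡[i-j]+j i j ⟩
  (i - j) + j ≤⟨ +-monoˡ-≤ j i-j≤k ⟩
  k + j       ≡⟨ +-comm k j ⟩
  j + k       ∎
  where open ≤-Reasoning

All-∷ʳ⁺ : ∀ {A : Set} {P : A → Set} {m} {xs : Vec A m} {x} → All P xs → P x → All P (xs ∷ʳ x)
All-∷ʳ⁺ []         px = px ∷ []
All-∷ʳ⁺ (py ∷ pys) px = py ∷ All-∷ʳ⁺ pys px

All-∷ʳ⁻ : ∀ {A : Set} {P : A → Set} {m} {xs : Vec A m} {x} → All P (xs ∷ʳ x) → All P xs × P x
All-∷ʳ⁻ {xs = []}    (px ∷ [])  = [] , px
All-∷ʳ⁻ {xs = _ ∷ _} (py ∷ pys) = let pys′ , px = All-∷ʳ⁻ pys in py ∷ pys′ , px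

AllPairs-∷ʳ⁺ : ∀ {A : Set} {R : A → A → Set} {m} {xs : Vec A m} {x} →
               AllPairs R xs → All (λ y → R y x) xs → AllPairs R (xs ∷ʳ x)
AllPairs-∷ʳ⁺ []           []           = [] ∷ []
AllPairs-∷ʳ⁺ (Ryys ∷ ys!) (Ryx ∷ Rysx) = All-∷ʳ⁺ Ryys Ryx ∷ AllPairs-∷ʳ⁺ ys! Rysx

AllPairs-∷ʳ⁻ : ∀ {A : Set} {R : A → A → Set} {m} {xs : Vec A m} {x} →
               AllPairs R (xs ∷ʳ x) → AllPairs R xs × All (λ y → R y x) xs
AllPairs-∷ʳ⁻ {xs = []}    _            = [] , []
AllPairs-∷ʳ⁻ {xs = _ ∷ _} (Ryys ∷ ys!) =
  let Ryys′ , Ryx = All-∷ʳ⁻ Ryys ; ys!′ , Rysx = AllPairs-∷ʳ⁻ ys! in Ryys′ ∷ ys!′ , Ryx ∷ Rysx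

∷≡∷ʳ : ∀ {A : Set} {m x} {xs : Vec A m} → All (_≡ x) xs → x ∷ xs ≡ xs ∷ʳ x
∷≡∷ʳ []           = refl
∷≡∷ʳ (refl ∷ xs≡) = cong (_ ∷_) (∷≡∷ʳ xs≡)

tabulate-const : ∀ {A : Set} {m} (q : A) → tabulate {n = m} (λ _ → q) ≡ replicate m q
tabulate-const {m = zero}  q = refl
tabulate-const {m = suc _} q = cong (q ∷_) (tabulate-const q)

∷ʳ-zipWith-replicate : ∀ {A B C : Set} {m} (f : A → B → C) (xs : Vec A m) x q →
                       zipWith f (xs ∷ʳ x) (replicate (suc m) q) ≡ zipWith f xs (replicate m q) ∷ʳ f x q
∷ʳ-zipWith-replicate f []       x q = refl
∷ʳ-zipWith-replicate f (_ ∷ xs) x q = cong (_ ∷_) (∷ʳ-zipWith-replicate f xs x q)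

zipWith-identityʳ : ∀ {A B : Set} {m} (f : A → B → A) {e} → (∀ y → f y e ≡ y) → (v : Vec A m) →
                    zipWith f v (tabulate (λ _ → e)) ≡ v
zipWith-identityʳ f f-y-e≡y []       = refl
zipWith-identityʳ f f-y-e≡y (y ∷ ys) = cong₂ _∷_ (f-y-e≡y y) (zipWith-identityʳ f f-y-e≡y ys)

decreasing⇒allPairs : ∀ {m} (v : Vec ℤ m) → Decreasing v → AllPairs _≥_ v
decreasing⇒allPairs []       _  = []
decreasing⇒allPairs (_ ∷ xs) v↓ =
  lookup⁻ (λ j → v↓ zero (suc j) z≤n)
  ∷ decreasing⇒allPairs xs (λ i j i≤j → v↓ (suc i) (suc j) (s≤s i≤j))

allPairs⇒decreasing : ∀ {m} {v : Vec ℤ m} → AllPairs _≥_ v → Decreasing v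
allPairs⇒decreasing (x≥xs ∷ _)   zero    zero    _         = ≤-refl
allPairs⇒decreasing (x≥xs ∷ _)   zero    (suc j) _         = lookup⁺ x≥xs j
allPairs⇒decreasing (_    ∷ xs↓) (suc i) (suc j) (s≤s i≤j) = allPairs⇒decreasing xs↓ i j i≤j

lookup≤head : ∀ {m x} {xs : Vec ℤ m} → AllPairs _≥_ (x ∷ xs) → ∀ i → lookup (x ∷ xs) i ≤ x
lookup≤head v↓ i = allPairs⇒decreasing v↓ zero i z≤n

IsMaxPos⇒lookup≡head : ∀ {m x} {xs : Vec ℤ m} c → AllPairs _≥_ (x ∷ xs) → IsMaxPos (x ∷ xs) c →
                       lookup (x ∷ xs) c ≡ x
IsMaxPos⇒lookup≡head c v↓ max = ≤-antisym (lookup≤head v↓ c) (max zero)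

Spread≤-window : ∀ {m} {v : Vec ℤ m} {lo hi : ℤ} {b : ℕ} →
                 All (λ y → lo ≤ y × y ≤ hi) v → hi - lo ≤ + b → Spread≤ v b
Spread≤-window within span i j =
  ≤-trans (+-mono-≤ (proj₂ (lookup⁺ within i)) (neg-mono-≤ (proj₁ (lookup⁺ within j)))) span

Spread≤-head : ∀ {m b} x (xs : Vec ℤ m) → Spread≤ (x ∷ xs) b → All (λ y → x - y ≤ + b) xs
Spread≤-head _ _ spread = lookup⁻ (λ j → spread zero (suc j))

Spread≤-last : ∀ {m b} (xs : Vec ℤ m) x → Spread≤ (xs ∷ʳ x) b → All (λ y → y - x ≤ + b) xs
Spread≤-last {b = b} xs x spread = All.map (proj₂ ∘ All-∷ʳ⁻) (proj₁ (All-∷ʳ⁻ pairwise))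
  where
  pairwise : All (λ y → All (λ z → y - z ≤ + b) (xs ∷ʳ x)) (xs ∷ʳ x)
  pairwise = lookup⁻ (λ i → lookup⁻ (spread i))

insertDec-head : ∀ {m x} {ys : Vec ℤ m} → All (_≤ x) ys → insertDec x ys ≡ x ∷ ys
insertDec-head [] = refl
insertDec-head {x = x} {y ∷ _} (y≤x ∷ _) with y ≤? x
... | yes _   = refl
... | no y≰x = contradiction y≤x y≰x

sortDec-id : ∀ {m} {v : Vec ℤ m} → AllPairs _≥_ v → sortDec v ≡ v
sortDec-id []                      = refl
sortDec-id {v = x ∷ _} (x≥xs ∷ xs↓) =
  trans (cong (insertDec x) (sortDec-id xs↓)) (insertDec-head x≥xs)

-- Insertion stops in front of the first entry ≤ x; if that entry equals x, so do all later ones.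
insertDec-last : ∀ {m x} {ys : Vec ℤ m} → AllPairs _≥_ ys → All (_≥ x) ys → insertDec x ys ≡ ys ∷ʳ x
insertDec-last []             []           = refl
insertDec-last {x = x} {y ∷ _} (y≥ys ∷ ys↓) (y≥x ∷ ys≥x) with y ≤? x
... | no _ = cong (y ∷_) (insertDec-last ys↓ ys≥x)
... | yes y≤x with ≤-antisym y≤x y≥x
...   | refl = cong (y ∷_) (∷≡∷ʳ (All.map (uncurry ≤-antisym) (All.zip (y≥ys , ys≥x))))

sortDec-[]≔-max : ∀ {m a} (w : Vec ℤ (suc m)) c → AllPairs _≥_ w → lookup w c ≡ head w →
                  All (_≥ a) (tail w) → sortDec (w [ c ]≔ a) ≡ tail w ∷ʳ a
sortDec-[]≔-max {a = a} (_ ∷ _) zero (_ ∷ ys↓) _ ys≥a =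
  trans (cong (insertDec a) (sortDec-id ys↓)) (insertDec-last ys↓ ys≥a)
sortDec-[]≔-max (y ∷ y′ ∷ ys) (suc c) (y≥ ∷ w↓) c≡y (y′≥a ∷ ys≥a)
  with ≤-antisym (All.head y≥) (subst (_≤ y′) c≡y (lookup≤head w↓ c))
... | refl = trans (cong (insertDec y) (sortDec-[]≔-max (y ∷ ys) c w↓ c≡y ys≥a))
                   (insertDec-head (All-∷ʳ⁺ (AllPairs.head w↓) y′≥a))

lookup-⊕-const : ∀ {m} (v : Vec ℤ m) q i → lookup (v ⊕ const q) i ≡ lookup v i + q
lookup-⊕-const v q i =
  trans (lookup-zipWith _+_ i v _) (cong (_+_ (lookup v i)) (lookup-replicate i q))

⊖-const≡⊕-const-neg : ∀ {m} (v : Vec ℤ m) q → v ⊖ const q ≡ v ⊕ const (- q)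
⊖-const≡⊕-const-neg []       q = refl
⊖-const≡⊕-const-neg (_ ∷ xs) q = cong (_ ∷_) (⊖-const≡⊕-const-neg xs q)

⊕-const-⊖-const : ∀ {m} (v : Vec ℤ m) q → v ⊕ const q ⊖ const q ≡ v
⊕-const-⊖-const []       q = refl
⊕-const-⊖-const (x ∷ xs) q = cong₂ _∷_ (i+j-j≡i x q) (⊕-const-⊖-const xs q)

⊖-const-⊕-const : ∀ {m} (v : Vec ℤ m) q → v ⊖ const q ⊕ const q ≡ v
⊖-const-⊕-const []       q = refl
⊖-const-⊕-const (x ∷ xs) q = cong₂ _∷_ (i-j+j≡i x q) (⊖-const-⊕-const xs q)

decreasing-⊕-const : ∀ {m} (v : Vec ℤ m) q → Decreasing v → Decreasing (v ⊕ const q)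
decreasing-⊕-const v q v↓ i j i≤j =
  subst₂ _≤_ (sym (lookup-⊕-const v q j)) (sym (lookup-⊕-const v q i)) (+-monoˡ-≤ q (v↓ i j i≤j))

spread-⊕-const : ∀ {m b} (v : Vec ℤ m) q → Spread≤ v b → Spread≤ (v ⊕ const q) b
spread-⊕-const {b = b} v q spread i j =
  subst (_≤ + b) (sym (trans (cong₂ _-_ (lookup-⊕-const v q i) (lookup-⊕-const v q j))
                             (i+k-[j+k]≡i-j (lookup v i) (lookup v j) q)))
        (spread i j)

All-⊕-const : ∀ {m} {P : ℤ → Set} {v : Vec ℤ m} q → All (λ y → P (y + q)) v → All P (v ⊕ const q)
All-⊕-const q []         = []
All-⊕-const q (py ∷ pys) = py ∷ All-⊕-const q pys

allPairs-⊕-const : ∀ {m} {v : Vec ℤ m} q → AllPairs _≥_ v → AllPairs _≥_ (v ⊕ const q)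
allPairs-⊕-const q []           = []
allPairs-⊕-const q (x≥xs ∷ xs↓) =
  All-⊕-const q (All.map (+-monoˡ-≤ q) x≥xs) ∷ allPairs-⊕-const q xs↓

⊕-tabulate-const : ∀ {m q} (v : Vec ℤ m) (h : Fin m → ℤ) → (∀ j → h j ≡ q) →
                   v ⊕ tabulate h ≡ v ⊕ const q
⊕-tabulate-const {q = q} v h h≡q = cong (v ⊕_) (trans (tabulate-cong h≡q) (tabulate-const q))

⊕-tabulate-[]≔ : ∀ {m q} (v : Vec ℤ m) c (h : Fin m → ℤ) → (∀ j → c ≢ j → h j ≡ q) →
                 v ⊕ tabulate h ≡ (v ⊕ const q) [ c ]≔ (lookup v c + h c)
⊕-tabulate-[]≔ (x ∷ xs) zero    h off =
  cong (x + h zero ∷_) (⊕-tabulate-const xs (h ∘ suc) (λ j → off (suc j) λ ()))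
⊕-tabulate-[]≔ (x ∷ xs) (suc c) h off =
  cong₂ _∷_ (cong (_+_ x) (off zero λ ()))
            (⊕-tabulate-[]≔ xs c (h ∘ suc) (λ j c≢j → off (suc j) (c≢j ∘ suc-injective)))

sortDec-⊕-tabulate-const : ∀ {m q} (v : Vec ℤ m) → Decreasing v →
                           sortDec (v ⊕ tabulate (λ _ → q)) ≡ v ⊕ const q
sortDec-⊕-tabulate-const {q = q} v v↓ =
  trans (cong sortDec (⊕-tabulate-const v _ λ _ → refl))
        (sortDec-id (allPairs-⊕-const q (decreasing⇒allPairs v v↓)))

sortDec-⊕-tabulate-max : ∀ {m p q} {x : ℤ} {xs : Vec ℤ m} c (h : Fin (suc m) → ℤ) →
  AllPairs _≥_ (x ∷ xs) → IsMaxPos (x ∷ xs) c → h c ≡ p → (∀ j → c ≢ j → h j ≡ q) →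
  All (λ y → y + q ≥ x + p) xs → sortDec ((x ∷ xs) ⊕ tabulate h) ≡ (xs ⊕ const q) ∷ʳ (x + p)
sortDec-⊕-tabulate-max {p = p} {q} {x} {xs} c h v↓ max hc≡p off xs+q≥x+p = begin
  sortDec ((x ∷ xs) ⊕ tabulate h)
    ≡⟨ cong sortDec (⊕-tabulate-[]≔ (x ∷ xs) c h off) ⟩
  sortDec (w [ c ]≔ (lookup (x ∷ xs) c + h c))
    ≡⟨ cong (λ a → sortDec (w [ c ]≔ a)) (cong₂ _+_ c≡x hc≡p) ⟩
  sortDec (w [ c ]≔ (x + p))
    ≡⟨ sortDec-[]≔-max w c (allPairs-⊕-const q v↓)
                       (trans (lookup-⊕-const (x ∷ xs) q c) (cong (_+ q) c≡x))
                       (All-⊕-const q xs+q≥x+p) ⟩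
  (xs ⊕ const q) ∷ʳ (x + p) ∎
  where
  open ≡-Reasoning
  w = (x ∷ xs) ⊕ const q
  c≡x = IsMaxPos⇒lookup≡head c v↓ max

Δ-vK-self : ∀ {n d} (c : Fin n) → Δ {n} {d} (vK c) (vK c) ≡ - + (n ℕ.+ d)
Δ-vK-self c with c ≟F c
... | yes _   = refl
... | no c≢c = contradiction refl c≢c

Δ-vK-other : ∀ {n d} (c j : Fin n) → c ≢ j → Δ {n} {d} (vK c) (vK j) ≡ + 1
Δ-vK-other c j c≢j with c ≟F j
... | yes c≡j = contradiction c≡j c≢j
... | no _    = refl

Δ-wI-self : ∀ {n d} (c : Fin d) → Δ {n} {d} (wI c) (wI c) ≡ - + (n ℕ.+ 1)
Δ-wI-self c with c ≟F c
... | yes _   = refl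
... | no c≢c = contradiction refl c≢c

Δ-wI-other : ∀ {n d} (c j : Fin d) → c ≢ j → Δ {n} {d} (wI c) (wI j) ≡ + 0
Δ-wI-other c j c≢j with c ≟F j
... | yes c≡j = contradiction c≡j c≢j
... | no _    = refl

τ⁻¹-∷ʳ : ∀ {m} x (xs : Vec ℤ m) → τ⁻¹ (xs ∷ʳ x) ≡ x ∷ xs
τ⁻¹-∷ʳ x []         = refl
τ⁻¹-∷ʳ x xs@(_ ∷ _) = cong₂ _∷_ (last-∷ʳ x xs) (init-∷ʳ x xs)

rotateDown rotateUp : ∀ {m} → ℤ → Vec ℤ m → Vec ℤ m
rotateDown a v = τ (v ⊖ at0 a)
rotateUp   a v = τ⁻¹ v ⊕ at0 a

rotateDown-∷ : ∀ {m} a x (xs : Vec ℤ m) → rotateDown a (x ∷ xs) ≡ xs ∷ʳ (x - a)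
rotateDown-∷ a x xs = cong (_∷ʳ (x - a)) (zipWith-identityʳ _-_ +-identityʳ xs)

rotateUp-∷ʳ : ∀ {m} a x (xs : Vec ℤ m) → rotateUp a (xs ∷ʳ x) ≡ (x + a) ∷ xs
rotateUp-∷ʳ a x xs =
  trans (cong (_⊕ at0 a) (τ⁻¹-∷ʳ x xs)) (cong ((x + a) ∷_) (zipWith-identityʳ _+_ +-identityʳ xs))

rotateUp-rotateDown : ∀ {m} a (v : Vec ℤ m) → rotateUp a (rotateDown a v) ≡ v
rotateUp-rotateDown a []       = refl
rotateUp-rotateDown a (x ∷ xs) = begin
  rotateUp a (rotateDown a (x ∷ xs)) ≡⟨ cong (rotateUp a) (rotateDown-∷ a x xs) ⟩
  rotateUp a (xs ∷ʳ (x - a))         ≡⟨ rotateUp-∷ʳ a (x - a) xs ⟩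
  (x - a + a) ∷ xs                   ≡⟨ cong (_∷ xs) (i-j+j≡i x a) ⟩
  x ∷ xs                             ∎
  where open ≡-Reasoning

rotateDown-rotateUp : ∀ {m} a (v : Vec ℤ m) → rotateDown a (rotateUp a v) ≡ v
rotateDown-rotateUp {zero}  a [] = refl
rotateDown-rotateUp {suc _} a v with initLast v
... | xs , x , refl = begin
  rotateDown a (rotateUp a (xs ∷ʳ x)) ≡⟨ cong (rotateDown a) (rotateUp-∷ʳ a x xs) ⟩
  rotateDown a ((x + a) ∷ xs)         ≡⟨ rotateDown-∷ a (x + a) xs ⟩
  xs ∷ʳ (x + a - a)                   ≡⟨ cong (xs ∷ʳ_) (i+j-j≡i x a) ⟩
  xs ∷ʳ x                             ∎
  where open ≡-Reasoning

τ-⊕-const : ∀ {m} (v : Vec ℤ m) q → τ (v ⊕ const q) ≡ τ v ⊕ const q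
τ-⊕-const []       q = refl
τ-⊕-const (x ∷ xs) q = sym (∷ʳ-zipWith-replicate _+_ xs x q)

rotateUp-⊕-const : ∀ {m} a (v : Vec ℤ m) q → rotateUp a (v ⊕ const q) ≡ rotateUp a v ⊕ const q
rotateUp-⊕-const {zero}  a [] q = refl
rotateUp-⊕-const {suc _} a v  q with initLast v
... | xs , x , refl = begin
  rotateUp a ((xs ∷ʳ x) ⊕ const q)      ≡⟨ cong (rotateUp a) (∷ʳ-zipWith-replicate _+_ xs x q) ⟩
  rotateUp a ((xs ⊕ const q) ∷ʳ (x + q)) ≡⟨ rotateUp-∷ʳ a (x + q) (xs ⊕ const q) ⟩
  (x + q + a) ∷ (xs ⊕ const q)           ≡⟨ cong (_∷ (xs ⊕ const q)) (i+j+k≡i+k+j x q a) ⟩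
  ((x + a) ∷ xs) ⊕ const q               ≡⟨ cong (_⊕ const q) (rotateUp-∷ʳ a x xs) ⟨
  rotateUp a (xs ∷ʳ x) ⊕ const q         ∎
  where open ≡-Reasoning

rotateDown-⊖-const : ∀ {m} a (v : Vec ℤ m) q → rotateDown a (v ⊖ const q) ≡ rotateDown a v ⊖ const q
rotateDown-⊖-const a []       q = refl
rotateDown-⊖-const a (x ∷ xs) q = begin
  rotateDown a ((x - q) ∷ (xs ⊖ const q)) ≡⟨ rotateDown-∷ a (x - q) (xs ⊖ const q) ⟩
  (xs ⊖ const q) ∷ʳ (x - q - a)           ≡⟨ cong ((xs ⊖ const q) ∷ʳ_) (i+j+k≡i+k+j x (- q) (- a)) ⟩
  (xs ⊖ const q) ∷ʳ (x - a - q)           ≡⟨ ∷ʳ-zipWith-replicate _-_ xs (x - a) q ⟨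
  (xs ∷ʳ (x - a)) ⊖ const q               ≡⟨ cong (_⊖ const q) (rotateDown-∷ a x xs) ⟨
  rotateDown a (x ∷ xs) ⊖ const q         ∎
  where open ≡-Reasoning

rotateDown-⊕-const-rotateUp-⊖-const : ∀ {m} a q (v : Vec ℤ m) →
                                      rotateDown a (rotateUp a v ⊖ const q) ⊕ const q ≡ v
rotateDown-⊕-const-rotateUp-⊖-const a q v = begin
  rotateDown a (rotateUp a v ⊖ const q) ⊕ const q
    ≡⟨ cong (_⊕ const q) (rotateDown-⊖-const a (rotateUp a v) q) ⟩
  rotateDown a (rotateUp a v) ⊖ const q ⊕ const q   ≡⟨ ⊖-const-⊕-const (rotateDown a (rotateUp a v)) q ⟩
  rotateDown a (rotateUp a v)                       ≡⟨ rotateDown-rotateUp a v ⟩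
  v                                                 ∎
  where open ≡-Reasoning

rotateUp-⊖-const-rotateDown-⊕-const : ∀ {m} a q (v : Vec ℤ m) →
                                      rotateUp a (rotateDown a v ⊕ const q) ⊖ const q ≡ v
rotateUp-⊖-const-rotateDown-⊕-const a q v = begin
  rotateUp a (rotateDown a v ⊕ const q) ⊖ const q
    ≡⟨ cong (_⊖ const q) (rotateUp-⊕-const a (rotateDown a v) q) ⟩
  rotateUp a (rotateDown a v) ⊕ const q ⊖ const q   ≡⟨ ⊕-const-⊖-const (rotateUp a (rotateDown a v)) q ⟩
  rotateUp a (rotateDown a v)                       ≡⟨ rotateUp-rotateDown a v ⟩
  v                                                 ∎
  where open ≡-Reasoning

record SortedCompact {m} (b : ℕ) (v : Vec ℤ m) : Set where
  constructor _,_
  field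
    decreasing : Decreasing v
    spread     : Spread≤ v b

sortedCompact-⊕-const : ∀ {m b} (v : Vec ℤ m) q → SortedCompact b v → SortedCompact b (v ⊕ const q)
sortedCompact-⊕-const v q (v↓ , spread) = decreasing-⊕-const v q v↓ , spread-⊕-const v q spread

sortedCompact-⊖-const : ∀ {m b} (v : Vec ℤ m) q → SortedCompact b v → SortedCompact b (v ⊖ const q)
sortedCompact-⊖-const {b = b} v q sc =
  subst (SortedCompact b) (sym (⊖-const≡⊕-const-neg v q)) (sortedCompact-⊕-const v (- q) sc)

sortedCompact-rotateDown : ∀ {m b} (v : Vec ℤ m) → SortedCompact b v →
                           SortedCompact b (rotateDown (+ b) v)
sortedCompact-rotateDown []       sc = sc
sortedCompact-rotateDown {b = b} (x ∷ xs) (v↓ , spread) =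
  subst (SortedCompact b) (sym (rotateDown-∷ (+ b) x xs))
    ( allPairs⇒decreasing (AllPairs-∷ʳ⁺ xs↓ xs≥x-b)
    , Spread≤-window (All-∷ʳ⁺ (All.zip (xs≥x-b , x≥xs)) (≤-refl , i-j≤i x (+ b)))
                     (≤-reflexive (i-[i-j]≡j x (+ b))))
  where
  x≥xs = AllPairs.head (decreasing⇒allPairs (x ∷ xs) v↓)
  xs↓  = AllPairs.tail (decreasing⇒allPairs (x ∷ xs) v↓)
  xs≥x-b : All (_≥ x - + b) xs
  xs≥x-b = All.map (i-j≤k⇒i-k≤j x _) (Spread≤-head x xs spread)

sortedCompact-rotateUp : ∀ {m b} (v : Vec ℤ m) → SortedCompact b v →
                         SortedCompact b (rotateUp (+ b) v)
sortedCompact-rotateUp {zero}  []  sc = sc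
sortedCompact-rotateUp {suc _} v   sc with initLast v
sortedCompact-rotateUp {suc _} {b} _ (v↓ , spread) | xs , x , refl =
  subst (SortedCompact b) (sym (rotateUp-∷ʳ (+ b) x xs))
    ( allPairs⇒decreasing (xs≤x+b ∷ xs↓)
    , Spread≤-window ((i≤i+j x (+ b) , ≤-refl) ∷ All.zip (xs≥x , xs≤x+b))
                     (≤-reflexive (i+j-i≡j x (+ b))))
  where
  xs↓  = proj₁ (AllPairs-∷ʳ⁻ (decreasing⇒allPairs (xs ∷ʳ x) v↓))
  xs≥x = proj₂ (AllPairs-∷ʳ⁻ (decreasing⇒allPairs (xs ∷ʳ x) v↓))
  xs≤x+b : All (_≤ x + + b) xs
  xs≤x+b = All.map (λ {y} → i-j≤k⇒i≤j+k y x) (Spread≤-last xs x spread)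

SortedCompactConfig : ∀ {n d} → Config n d → Set
SortedCompactConfig u = Sorted u × Compact u

sortedCompactConfig : ∀ {n d} (uK : Vec ℤ n) (uI : Vec ℤ d) →
  SortedCompact (n ℕ.+ d ℕ.+ 1) uK → SortedCompact (n ℕ.+ 1) uI → SortedCompactConfig (uK , uI)
sortedCompactConfig _ _ (uK↓ , uK~) (uI↓ , uI~) = (uK↓ , uI↓) , (uK~ , uI~)

T-s-formula : ∀ {n d} (u : Config n d) → Sorted u →
  T-s u ≡ (proj₁ u ⊕ const (+ 1) , proj₂ u ⊕ const (+ 1))
T-s-formula (uK , uI) (uK↓ , uI↓) =
  cong₂ _,_ (sortDec-⊕-tabulate-const uK uK↓) (sortDec-⊕-tabulate-const uI uI↓)

T-K-formula : ∀ {m d} (u : Config (suc m) d) → Sorted u → Compact u → ∀ c → IsMaxPos (proj₁ u) c →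
  T-K c u ≡ (τ (proj₁ u ⊖ at0 (+ (suc m ℕ.+ d ℕ.+ 1)) ⊕ const (+ 1)) , proj₂ u ⊕ const (+ 1))
T-K-formula {m} {d} (x ∷ xs , uI) (uK↓ , uI↓) (spread , _) c max =
  cong₂ _,_ K-part (sortDec-⊕-tabulate-const uI uI↓)
  where
  N = suc m ℕ.+ d
  b = + (N ℕ.+ 1)
  toppleK : Fin (suc m) → ℤ
  toppleK i = Δ {suc m} {d} (vK c) (vK i)
  x-N≡x-b+1 : x - + N ≡ x - b + + 1
  x-N≡x-b+1 = sym (trans (cong (λ k → x - k + + 1) (pos-+ N 1)) (i-[j+1]+1≡i-j x (+ N)))
  xs+1≥x-N : All (λ y → y + + 1 ≥ x - + N) xs
  xs+1≥x-N = All.map (λ {y} x-y≤b → subst (_≤ y + + 1) (sym x-N≡x-b+1)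
                                          (+-monoˡ-≤ (+ 1) (i-j≤k⇒i-k≤j x y x-y≤b)))
                     (Spread≤-head x xs spread)
  open ≡-Reasoning
  K-part : sortDec ((x ∷ xs) ⊕ tabulate toppleK) ≡ τ ((x ∷ xs) ⊖ at0 b ⊕ const (+ 1))
  K-part = begin
    sortDec ((x ∷ xs) ⊕ tabulate toppleK)
      ≡⟨ sortDec-⊕-tabulate-max c toppleK (decreasing⇒allPairs (x ∷ xs) uK↓) max
                                (Δ-vK-self c) (Δ-vK-other c) xs+1≥x-N ⟩
    (xs ⊕ const (+ 1)) ∷ʳ (x - + N)       ≡⟨ cong ((xs ⊕ const (+ 1)) ∷ʳ_) x-N≡x-b+1 ⟩
    (xs ⊕ const (+ 1)) ∷ʳ (x - b + + 1)   ≡⟨ ∷ʳ-zipWith-replicate _+_ xs (x - b) (+ 1) ⟨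
    (xs ∷ʳ (x - b)) ⊕ const (+ 1)         ≡⟨ cong (_⊕ const (+ 1)) (rotateDown-∷ b x xs) ⟨
    rotateDown b (x ∷ xs) ⊕ const (+ 1)   ≡⟨ τ-⊕-const ((x ∷ xs) ⊖ at0 b) (+ 1) ⟨
    τ ((x ∷ xs) ⊖ at0 b ⊕ const (+ 1))    ∎

T-I-formula : ∀ {n d} (u : Config n d) → Sorted u → Compact u → ∀ c → IsMaxPos (proj₂ u) c →
  T-I c u ≡ (proj₁ u ⊕ const (+ 1) , τ (proj₂ u ⊖ at0 (+ (n ℕ.+ 1))))
T-I-formula (_ , []) _ _ () _
T-I-formula {n} {d} (uK , y ∷ ys) (uK↓ , uI↓) (_ , spread) c max =
  cong₂ _,_ (sortDec-⊕-tabulate-const uK uK↓) I-part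
  where
  M = + (n ℕ.+ 1)
  toppleI : Fin d → ℤ
  toppleI j = Δ {n} {d} (wI c) (wI j)
  ys≥y-M : All (λ z → z + + 0 ≥ y - M) ys
  ys≥y-M = All.map (λ {z} y-z≤M → subst (y - M ≤_) (sym (+-identityʳ z)) (i-j≤k⇒i-k≤j y z y-z≤M))
                   (Spread≤-head y ys spread)
  open ≡-Reasoning
  I-part : sortDec ((y ∷ ys) ⊕ tabulate toppleI) ≡ τ ((y ∷ ys) ⊖ at0 M)
  I-part = begin
    sortDec ((y ∷ ys) ⊕ tabulate toppleI)
      ≡⟨ sortDec-⊕-tabulate-max c toppleI (decreasing⇒allPairs (y ∷ ys) uI↓) max
                                (Δ-wI-self c) (Δ-wI-other c) ys≥y-M ⟩
    (ys ⊕ const (+ 0)) ∷ʳ (y - M)          ≡⟨ cong (_∷ʳ (y - M)) (⊕-tabulate-const ys _ (λ _ → refl)) ⟨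
    (ys ⊕ tabulate (λ _ → + 0)) ∷ʳ (y - M) ≡⟨ cong (_∷ʳ (y - M)) (zipWith-identityʳ _+_ +-identityʳ ys) ⟩
    ys ∷ʳ (y - M)                          ≡⟨ rotateDown-∷ M y ys ⟨
    rotateDown M (y ∷ ys)                  ∎

T-s-sortedCompact : ∀ {n d} (u : Config n d) → Sorted u → Compact u → SortedCompactConfig (T-s u)
T-s-sortedCompact u@(uK , uI) s@(uK↓ , uI↓) (uK~ , uI~) =
  subst SortedCompactConfig (sym (T-s-formula u s))
    (sortedCompactConfig _ _ (sortedCompact-⊕-const uK (+ 1) (uK↓ , uK~))
                             (sortedCompact-⊕-const uI (+ 1) (uI↓ , uI~)))

T-K-sortedCompact : ∀ {m d} (u : Config (suc m) d) → Sorted u → Compact u →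
  ∀ c → IsMaxPos (proj₁ u) c → SortedCompactConfig (T-K c u)
T-K-sortedCompact {m} {d} u@(uK , uI) s@(uK↓ , uI↓) cp@(uK~ , uI~) c max =
  subst SortedCompactConfig (sym (T-K-formula u s cp c max))
    (sortedCompactConfig _ _
      (subst (SortedCompact _) (sym (τ-⊕-const (uK ⊖ at0 b) (+ 1)))
             (sortedCompact-⊕-const (rotateDown b uK) (+ 1) (sortedCompact-rotateDown uK (uK↓ , uK~))))
      (sortedCompact-⊕-const uI (+ 1) (uI↓ , uI~)))
  where
  b = + (suc m ℕ.+ d ℕ.+ 1)

T-I-sortedCompact : ∀ {n d} (u : Config n d) → Sorted u → Compact u →
  ∀ c → IsMaxPos (proj₂ u) c → SortedCompactConfig (T-I c u)
T-I-sortedCompact u@(uK , uI) s@(uK↓ , uI↓) cp@(uK~ , uI~) c max =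
  subst SortedCompactConfig (sym (T-I-formula u s cp c max))
    (sortedCompactConfig _ _ (sortedCompact-⊕-const uK (+ 1) (uK↓ , uK~))
                             (sortedCompact-rotateDown uI (uI↓ , uI~)))

T-s-reversible : ∀ {n d} (u : Config n d) → Sorted u → Compact u →
  Sorted (Tinv-s u) × Compact (Tinv-s u) × T-s (Tinv-s u) ≡ u × Tinv-s (T-s u) ≡ u
T-s-reversible u@(uK , uI) s@(uK↓ , uI↓) (uK~ , uI~) =
    proj₁ sc′ , proj₂ sc′
  , trans (T-s-formula (Tinv-s u) (proj₁ sc′))
          (cong₂ _,_ (⊖-const-⊕-const uK (+ 1)) (⊖-const-⊕-const uI (+ 1)))
  , trans (cong Tinv-s (T-s-formula u s))
          (cong₂ _,_ (⊕-const-⊖-const uK (+ 1)) (⊕-const-⊖-const uI (+ 1)))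
  where
  sc′ : SortedCompactConfig (Tinv-s u)
  sc′ = sortedCompactConfig _ _ (sortedCompact-⊖-const uK (+ 1) (uK↓ , uK~))
                                (sortedCompact-⊖-const uI (+ 1) (uI↓ , uI~))

T-K-reversible : ∀ {m d} (u : Config (suc m) d) → Sorted u → Compact u →
  Sorted (Tinv-K u) × Compact (Tinv-K u)
  × (∀ c → IsMaxPos (proj₁ (Tinv-K u)) c → T-K c (Tinv-K u) ≡ u)
  × (∀ c → IsMaxPos (proj₁ u) c → Tinv-K (T-K c u) ≡ u)
T-K-reversible {m} {d} u@(uK , uI) s@(uK↓ , uI↓) cp@(uK~ , uI~) =
    proj₁ sc′ , proj₂ sc′
  , (λ c max → trans (T-K-formula (Tinv-K u) (proj₁ sc′) (proj₂ sc′) c max)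
      (cong₂ _,_ (trans (τ-⊕-const (rotateUp b uK ⊖ const (+ 1) ⊖ at0 b) (+ 1))
                        (rotateDown-⊕-const-rotateUp-⊖-const b (+ 1) uK))
                 (⊖-const-⊕-const uI (+ 1))))
  , (λ c max → trans (cong Tinv-K (T-K-formula u s cp c max))
      (cong₂ _,_ (trans (cong (λ w → rotateUp b w ⊖ const (+ 1)) (τ-⊕-const (uK ⊖ at0 b) (+ 1)))
                        (rotateUp-⊖-const-rotateDown-⊕-const b (+ 1) uK))
                 (⊕-const-⊖-const uI (+ 1))))
  where
  b = + (suc m ℕ.+ d ℕ.+ 1)
  sc′ : SortedCompactConfig (Tinv-K u)
  sc′ = sortedCompactConfig _ _
          (sortedCompact-⊖-const (rotateUp b uK) (+ 1) (sortedCompact-rotateUp uK (uK↓ , uK~)))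
          (sortedCompact-⊖-const uI (+ 1) (uI↓ , uI~))

T-I-reversible : ∀ {n d} (u : Config n d) → Sorted u → Compact u →
  Sorted (Tinv-I u) × Compact (Tinv-I u)
  × (∀ c → IsMaxPos (proj₂ (Tinv-I u)) c → T-I c (Tinv-I u) ≡ u)
  × (∀ c → IsMaxPos (proj₂ u) c → Tinv-I (T-I c u) ≡ u)
T-I-reversible {n} u@(uK , uI) s@(uK↓ , uI↓) cp@(uK~ , uI~) =
    proj₁ sc′ , proj₂ sc′
  , (λ c max → trans (T-I-formula (Tinv-I u) (proj₁ sc′) (proj₂ sc′) c max)
      (cong₂ _,_ (⊖-const-⊕-const uK (+ 1)) (rotateDown-rotateUp M uI)))
  , (λ c max → trans (cong Tinv-I (T-I-formula u s cp c max))
      (cong₂ _,_ (⊕-const-⊖-const uK (+ 1)) (rotateUp-rotateDown M uI)))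
  where
  M = + (n ℕ.+ 1)
  sc′ : SortedCompactConfig (Tinv-I u)
  sc′ = sortedCompactConfig _ _ (sortedCompact-⊖-const uK (+ 1) (uK↓ , uK~))
                                (sortedCompact-rotateUp uI (uI↓ , uI~))

proposition5p4 : (n d : ℕ) → 1 ℕ.≤ n → (u : Config n d) → Sorted u → Compact u →
    -- explicit formulas (c ranges over all admissible choices of a maximal vertex)
    (T-s u ≡ (proj₁ u ⊕ const (+ 1) , proj₂ u ⊕ const (+ 1)))
    × (∀ c → IsMaxPos (proj₁ u) c →
         T-K c u ≡ (τ (proj₁ u ⊖ at0 (+ (n ℕ.+ d ℕ.+ 1)) ⊕ const (+ 1)) , proj₂ u ⊕ const (+ 1)))
    × (∀ c → IsMaxPos (proj₂ u) c →
         T-I c u ≡ (proj₁ u ⊕ const (+ 1) , τ (proj₂ u ⊖ at0 (+ (n ℕ.+ 1)))))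
    -- the images are (sorted) compact configurations
    × (Sorted (T-s u) × Compact (T-s u))
    × (∀ c → IsMaxPos (proj₁ u) c → Sorted (T-K c u) × Compact (T-K c u))
    × (∀ c → IsMaxPos (proj₂ u) c → Sorted (T-I c u) × Compact (T-I c u))
    -- reversibility on sorted compact configurations, with the explicit inverses
    × (Sorted (Tinv-s u) × Compact (Tinv-s u)
         × T-s (Tinv-s u) ≡ u × Tinv-s (T-s u) ≡ u)
    × (Sorted (Tinv-K u) × Compact (Tinv-K u)
         × (∀ c → IsMaxPos (proj₁ (Tinv-K u)) c → T-K c (Tinv-K u) ≡ u)
         × (∀ c → IsMaxPos (proj₁ u) c → Tinv-K (T-K c u) ≡ u))
    × (Sorted (Tinv-I u) × Compact (Tinv-I u)
         × (∀ c → IsMaxPos (proj₂ (Tinv-I u)) c → T-I c (Tinv-I u) ≡ u)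
         × (∀ c → IsMaxPos (proj₂ u) c → Tinv-I (T-I c u) ≡ u))
proposition5p4 (suc m) d _ u sorted compact =
    T-s-formula u sorted
  , T-K-formula u sorted compact
  , T-I-formula u sorted compact
  , T-s-sortedCompact u sorted compact
  , T-K-sortedCompact u sorted compact
  , T-I-sortedCompact u sorted compact
  , T-s-reversible u sorted compact
  , T-K-reversible u sorted compact
  , T-I-reversible u sorted compact
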